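{- For any integers $a,b\ge 3$ with $a\le 2b-1$, there exists a graph $G$ such that $\gamma_R(G)=a$ and $\gamma^{p}_{I}(G)=b$.
   Context: All graphs are finite and simple. A perfect Italian dominating function (PID-function) of a graph $G$ is a function $f:V(G)\to\{0,1,2\}$ such that for every vertex $v$ with $f(v)=0$ we have $\sum_{u\in N(v)}f(u)=2$, where $N(v)$ is the open neighborhood of $v$. The weight of a function $f:V(G)\to\{0,1,2\}$ is $\sum_{u\in V(G)}f(u)$. The perfect Italian domination number $\gamma^{p}_{I}(G)$ is the minimum weight of a PID-function of $G$. A Roman dominating function of $G$ is a function $f:V(G)\to\{0,1,2\}$ such that every vertex $v$ with $f(v)=0$ has a neighbor $u$ with $f(u)=2$; the Roman domination number $\gamma_R(G)$ is the minimum weight of a Roman dominating function of $G$. -}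

module Defs where

open import Data.Nat using (ℕ; _≤_)
open import Data.Fin using (Fin; toℕ)
open import Data.Bool using (Bool; true; false; if_then_else_)
open import Data.Vec.Functional using (foldr)
open import Data.Product using (Σ; _×_; ∃)
open import Relation.Binary.PropositionalEquality using (_≡_; _≢_)

record Graph : Set where
  field
    n     : ℕ
    adj   : Fin n → Fin n → Bool
    sym   : ∀ u v → adj u v ≡ adj v u
    irref : ∀ v → adj v v ≡ false
open Graph public

Σ[_] : ∀ {m} → (Fin m → ℕ) → ℕ
Σ[ g ] = foldr Data.Nat._+_ 0 g

Labeling : Graph → Set
Labeling G = Fin (n G) → Fin 3

val : ∀ {G} → Labeling G → Fin (n G) → ℕ
val f v = toℕ (f v)

weight : (G : Graph) → Labeling G → ℕ
weight G f = Σ[ val {G} f ]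

nbSum : (G : Graph) → Labeling G → Fin (n G) → ℕ
nbSum G f v = Σ[ (λ u → if adj G v u then val {G} f u else 0) ]

IsPID : (G : Graph) → Labeling G → Set
IsPID G f = ∀ v → val {G} f v ≡ 0 → nbSum G f v ≡ 2

IsRDF : (G : Graph) → Labeling G → Set
IsRDF G f = ∀ v → val {G} f v ≡ 0 →
  Σ (Fin (n G)) (λ u → (adj G v u ≡ true) × (val {G} f u ≡ 2))

MinWeight : (G : Graph) → (Labeling G → Set) → ℕ → Set
MinWeight G P k =
  Σ (Labeling G) (λ f → P f × (weight G f ≡ k)) ×
  (∀ f → P f → k ≤ weight G f)

RomanNumber : Graph → ℕ → Set
RomanNumber G k = MinWeight G (IsRDF G) k

PerfectItalianNumber : Graph → ℕ → Set
PerfectItalianNumber G k = MinWeight G (IsPID G) k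

-- Both parameters are additive over disjoint unions, and an isolated vertex
-- contributes exactly 1 to each, so it suffices to realize a suitable pair
-- (a₀, b₀) with a − a₀ = b − b₀ ≥ 0 and pad with isolated vertices:
--   * a = b : the edgeless graph on a vertices;
--   * a < b : the clique fan F(k), a centre u joined to a clique y₀,…,y_k and
--     to k+4 leaves, plus a vertex w pendant at y₀; γ_R = 3, γ_I^p = k+4;
--   * a > b : the hub graph H(j), with j+1 hubs and, for every ordered pair
--     of distinct hubs, 2(j+1) private common neighbours ("connectors");
--     γ_R = 2j+1 and, for j ≥ 1, γ_I^p = j+1.
-- Graphs are built on structured vertex types (sums and products of Fin,
-- described by a small code universe) and transported to the representation
-- on Fin n along an explicit bijection, which preserves both minimum weights.
module Submission where

open import Defs hiding (sym; n)
open import Data.Nat using (ℕ; zero; suc; _+_; _*_; _∸_; _≤_; _<_; z≤n; s≤s; _≤?_)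
open import Data.Nat.Properties
open import Data.Nat.Tactic.RingSolver using (solve-∀)
open import Algebra.Properties.CommutativeMonoid.Sum +-0-commutativeMonoid
  using (sum-cong-≗; ∑-distrib-+; sum-remove; sum-replicate-zero)
open import Data.Fin using (Fin; zero; suc; toℕ; _↑ˡ_; _↑ʳ_; splitAt; join; combine; remQuot; punchIn; punchOut)
open import Data.Fin.Properties
  using (splitAt-↑ˡ; splitAt-↑ʳ; join-splitAt; remQuot-combine; combine-remQuot; punchInᵢ≢i; punchIn-punchOut; all?; ¬∀⟶∃¬)
  renaming (_≟_ to _≟F_)
open import Data.Bool using (Bool; true; false; if_then_else_; _∨_; not)
open import Data.Bool.Properties using (∨-comm)
open import Data.Sum using (_⊎_; inj₁; inj₂; [_,_]′)
open import Data.Product using (Σ; _×_; _,_; proj₁; proj₂)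
open import Function using (_∘_)
open import Relation.Binary using (tri<; tri≈; tri>)
open import Relation.Binary.PropositionalEquality
open import Relation.Nullary using (¬_; yes; no; does; contradiction)
open import Relation.Nullary.Decidable using (¬?; _→-dec_; dec-true; dec-false)

Σ-mono : ∀ {n} (g h : Fin n → ℕ) → (∀ i → g i ≤ h i) → Σ[ g ] ≤ Σ[ h ]
Σ-mono {zero}  g h g≤h = z≤n
Σ-mono {suc n} g h g≤h = +-mono-≤ (g≤h zero) (Σ-mono (g ∘ suc) (h ∘ suc) (g≤h ∘ suc))

Σ-const : ∀ n c → Σ[ (λ (_ : Fin n) → c) ] ≡ n * c
Σ-const zero    c = refl
Σ-const (suc n) c = cong (c +_) (Σ-const n c)

Σ-ones : ∀ n → Σ[ (λ (_ : Fin n) → 1) ] ≡ n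
Σ-ones n = trans (Σ-const n 1) (*-identityʳ n)

Σ-lower : ∀ {n} (g : Fin n → ℕ) c → (∀ i → c ≤ g i) → n * c ≤ Σ[ g ]
Σ-lower {n} g c c≤g = subst (_≤ Σ[ g ]) (Σ-const n c) (Σ-mono (λ _ → c) g c≤g)

Σ-positive : ∀ {n} (g : Fin n → ℕ) → (∀ i → 1 ≤ g i) → n ≤ Σ[ g ]
Σ-positive {n} g 1≤g = subst (_≤ Σ[ g ]) (*-identityʳ n) (Σ-lower g 1 1≤g)

Σ-point : ∀ {n} (g : Fin n → ℕ) i → g i ≤ Σ[ g ]
Σ-point {suc n} g i = subst (g i ≤_) (sym (sum-remove {i = i} g)) (m≤m+n (g i) _)

Σ-except : ∀ {n} (g : Fin (suc n) → ℕ) i → (∀ h → h ≢ i → 2 ≤ g h) → g i + n * 2 ≤ Σ[ g ]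
Σ-except {n} g i high = subst (g i + n * 2 ≤_) (sym (sum-remove {i = i} g))
  (+-monoʳ-≤ (g i) (Σ-lower (g ∘ punchIn i) 2 (λ j → high (punchIn i j) (punchInᵢ≢i i j))))

Σ-++ : ∀ m {n} (h : Fin (m + n) → ℕ) → Σ[ h ] ≡ Σ[ (λ i → h (i ↑ˡ n)) ] + Σ[ (λ j → h (m ↑ʳ j)) ]
Σ-++ zero    h = refl
Σ-++ (suc m) h = trans (cong (h zero +_) (Σ-++ m (h ∘ suc))) (sym (+-assoc (h zero) _ _))

Σ-combine : ∀ m n (h : Fin (m * n) → ℕ) → Σ[ h ] ≡ Σ[ (λ (i : Fin m) → Σ[ (λ (j : Fin n) → h (combine i j)) ]) ]
Σ-combine zero    n h = refl
Σ-combine (suc m) n h = trans (Σ-++ n h) (cong (Σ[ (λ (j : Fin n) → h (j ↑ˡ (m * n))) ] +_) (Σ-combine m n (h ∘ (n ↑ʳ_))))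

_==_ : ∀ {n} → Fin n → Fin n → Bool
x == y = does (x ≟F y)

==-refl : ∀ {n} (x : Fin n) → x == x ≡ true
==-refl x = dec-true (x ≟F x) refl

==-false : ∀ {n} {x y : Fin n} → x ≢ y → x == y ≡ false
==-false {x = x} {y} = dec-false (x ≟F y)

==-sound : ∀ {n} (x y : Fin n) → x == y ≡ true → x ≡ y
==-sound x y eq with x ≟F y | eq
... | yes x≡y | _  = x≡y
... | no  _   | ()

∨-true : ∀ p q → p ∨ q ≡ true → (p ≡ true) ⊎ (q ≡ true)
∨-true true  q eq = inj₁ refl
∨-true false q eq = inj₂ eq

Σ-single : ∀ {n} (g : Fin n → ℕ) i → Σ[ (λ h → if h == i then g h else 0) ] ≡ g i
Σ-single {suc n} g zero    = trans (cong (g zero +_) (sum-replicate-zero n)) (+-identityʳ _)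
Σ-single {suc n} g (suc i) = Σ-single (g ∘ suc) i

Σ-pair : ∀ {n} (g : Fin n → ℕ) i p → i ≢ p → Σ[ (λ h → if h == i ∨ h == p then g h else 0) ] ≡ g i + g p
Σ-pair g i p i≢p = begin
  Σ[ (λ h → if h == i ∨ h == p then g h else 0) ]
    ≡⟨ sum-cong-≗ split ⟩
  Σ[ (λ h → (if h == i then g h else 0) + (if h == p then g h else 0)) ]
    ≡⟨ ∑-distrib-+ (λ h → if h == i then g h else 0) (λ h → if h == p then g h else 0) ⟩
  Σ[ (λ h → if h == i then g h else 0) ] + Σ[ (λ h → if h == p then g h else 0) ]
    ≡⟨ cong₂ _+_ (Σ-single g i) (Σ-single g p) ⟩
  g i + g p ∎
  where
  open ≡-Reasoning
  split : ∀ h → (if h == i ∨ h == p then g h else 0) ≡ (if h == i then g h else 0) + (if h == p then g h else 0)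
  split h with h == i in h=i | h == p in h=p
  ... | true  | true  = contradiction (trans (sym (==-sound h i h=i)) (==-sound h p h=p)) i≢p
  ... | true  | false = sym (+-identityʳ _)
  ... | false | true  = refl
  ... | false | false = refl

data Code : Set where
  fin : ℕ → Code
  _⊕_ : Code → Code → Code
  _⊗_ : Code → Code → Code

El : Code → Set
El (fin n) = Fin n
El (c ⊕ d) = El c ⊎ El d
El (c ⊗ d) = El c × El d

size : Code → ℕ
size (fin n) = n
size (c ⊕ d) = size c + size d
size (c ⊗ d) = size c * size d

enc : ∀ c → El c → Fin (size c)
enc (fin n) x        = x
enc (c ⊕ d) (inj₁ x) = enc c x ↑ˡ size d
enc (c ⊕ d) (inj₂ y) = size c ↑ʳ enc d y
enc (c ⊗ d) (x , y)  = combine (enc c x) (enc d y)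

dec : ∀ c → Fin (size c) → El c
dec (fin n) x = x
dec (c ⊕ d) x = [ (λ a → inj₁ (dec c a)) , (λ b → inj₂ (dec d b)) ]′ (splitAt (size c) x)
dec (c ⊗ d) x = dec c (proj₁ (remQuot {size c} (size d) x)) , dec d (proj₂ (remQuot {size c} (size d) x))

dec-enc : ∀ c t → dec c (enc c t) ≡ t
dec-enc (fin n) t = refl
dec-enc (c ⊕ d) (inj₁ x) rewrite splitAt-↑ˡ (size c) (enc c x) (size d) | dec-enc c x = refl
dec-enc (c ⊕ d) (inj₂ y) rewrite splitAt-↑ʳ (size c) (size d) (enc d y) | dec-enc d y = refl
dec-enc (c ⊗ d) (x , y) =
  trans (cong (λ p → dec c (proj₁ p) , dec d (proj₂ p)) (remQuot-combine {size c} {size d} (enc c x) (enc d y)))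
        (cong₂ _,_ (dec-enc c x) (dec-enc d y))

enc-dec : ∀ c x → enc c (dec c x) ≡ x
enc-dec (fin n) x = refl
enc-dec (c ⊕ d) x with splitAt (size c) x in eq
... | inj₁ a rewrite enc-dec c a = trans (cong (join (size c) (size d)) (sym eq)) (join-splitAt (size c) (size d) x)
... | inj₂ b rewrite enc-dec d b = trans (cong (join (size c) (size d)) (sym eq)) (join-splitAt (size c) (size d) x)
enc-dec (c ⊗ d) x
  rewrite enc-dec c (proj₁ (remQuot {size c} (size d) x)) | enc-dec d (proj₂ (remQuot {size c} (size d) x))
  = combine-remQuot {size c} (size d) x

ΣT : ∀ c → (El c → ℕ) → ℕ
ΣT (fin n) g = Σ[ g ]
ΣT (c ⊕ d) g = ΣT c (g ∘ inj₁) + ΣT d (g ∘ inj₂)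
ΣT (c ⊗ d) g = ΣT c (λ x → ΣT d (λ y → g (x , y)))

ΣT-cong : ∀ c {g h : El c → ℕ} → (∀ t → g t ≡ h t) → ΣT c g ≡ ΣT c h
ΣT-cong (fin n) g≗h = sum-cong-≗ g≗h
ΣT-cong (c ⊕ d) g≗h = cong₂ _+_ (ΣT-cong c (g≗h ∘ inj₁)) (ΣT-cong d (g≗h ∘ inj₂))
ΣT-cong (c ⊗ d) g≗h = ΣT-cong c (λ x → ΣT-cong d (λ y → g≗h (x , y)))

ΣT-zero : ∀ c → ΣT c (λ _ → 0) ≡ 0
ΣT-zero (fin n) = sum-replicate-zero n
ΣT-zero (c ⊕ d) = cong₂ _+_ (ΣT-zero c) (ΣT-zero d)
ΣT-zero (c ⊗ d) = trans (ΣT-cong c (λ _ → ΣT-zero d)) (ΣT-zero c)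

ΣT-point : ∀ c (g : El c → ℕ) t → g t ≤ ΣT c g
ΣT-point (fin n) g t        = Σ-point g t
ΣT-point (c ⊕ d) g (inj₁ x) = ≤-trans (ΣT-point c _ x) (m≤m+n _ _)
ΣT-point (c ⊕ d) g (inj₂ y) = ≤-trans (ΣT-point d _ y) (m≤n+m _ _)
ΣT-point (c ⊗ d) g (x , y)  = ≤-trans (ΣT-point d _ y) (ΣT-point c (λ x → ΣT d (λ y → g (x , y))) x)

Σ-enc : ∀ c (h : Fin (size c) → ℕ) → Σ[ h ] ≡ ΣT c (h ∘ enc c)
Σ-enc (fin n) h = refl
Σ-enc (c ⊕ d) h = trans (Σ-++ (size c) h) (cong₂ _+_ (Σ-enc c _) (Σ-enc d _))
Σ-enc (c ⊗ d) h = trans (Σ-combine (size c) (size d) h)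
  (trans (sum-cong-≗ (λ i → Σ-enc d (h ∘ combine {size c} i)))
         (Σ-enc c (λ i → ΣT d (h ∘ combine {size c} i ∘ enc d))))

record CGraph : Set where
  field
    code  : Code
    A     : El code → El code → Bool
    A-sym : ∀ s t → A s t ≡ A t s
    A-irr : ∀ t → A t t ≡ false
open CGraph

-- The graph whose edges are the pairs related by an irreflexive relation E,
-- in either direction; this discharges symmetry once and for all.
fromEdges : (c : Code) (E : El c → El c → Bool) → (∀ t → E t t ≡ false) → CGraph
fromEdges c E E-irr = record
  { code  = c
  ; A     = λ s t → E s t ∨ E t s
  ; A-sym = λ s t → ∨-comm (E s t) (E t s)
  ; A-irr = λ t → cong₂ _∨_ (E-irr t) (E-irr t) }

Lab : CGraph → Set
Lab S = El (code S) → Fin 3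

value : {X : Set} → (X → Fin 3) → X → ℕ
value f x = toℕ (f x)

W : (S : CGraph) → Lab S → ℕ
W S f = ΣT (code S) (value f)

NB : (S : CGraph) → Lab S → El (code S) → ℕ
NB S f t = ΣT (code S) (λ s → if A S t s then value f s else 0)

RDF : (S : CGraph) → Lab S → Set
RDF S f = ∀ t → value f t ≡ 0 → Σ (El (code S)) (λ s → (A S t s ≡ true) × (value f s ≡ 2))

PID : (S : CGraph) → Lab S → Set
PID S f = ∀ t → value f t ≡ 0 → NB S f t ≡ 2

MinW : (S : CGraph) → (Lab S → Set) → ℕ → Set
MinW S P k = Σ (Lab S) (λ f → P f × (W S f ≡ k)) × (∀ f → P f → k ≤ W S f)

toGraph : CGraph → Graph
toGraph S = record
  { n     = size (code S)
  ; adj   = λ x y → A S (dec (code S) x) (dec (code S) y)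
  ; sym   = λ x y → A-sym S _ _
  ; irref = λ x → A-irr S _ }

module Transport (S : CGraph) where
  private
    c = code S
    G = toGraph S

  down : Lab S → Labeling G
  down f = f ∘ dec c

  up : Labeling G → Lab S
  up f = f ∘ enc c

  weight-down : ∀ f → weight G (down f) ≡ W S f
  weight-down f = trans (Σ-enc c _) (ΣT-cong c (λ t → cong (value f) (dec-enc c t)))

  weight-up : ∀ f → weight G f ≡ W S (up f)
  weight-up f = Σ-enc c _

  nbSum-down : ∀ f x → nbSum G (down f) x ≡ NB S f (dec c x)
  nbSum-down f x = trans (Σ-enc c _)
    (ΣT-cong c (λ t → cong (λ s → if A S (dec c x) s then value f s else 0) (dec-enc c t)))

  nbSum-up : ∀ f t → nbSum G f (enc c t) ≡ NB S (up f) t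
  nbSum-up f t = trans (Σ-enc c _) (ΣT-cong c adjacent)
    where
    adjacent : ∀ s → (if A S (dec c (enc c t)) (dec c (enc c s)) then value (up f) s else 0)
                   ≡ (if A S t s then value (up f) s else 0)
    adjacent s = cong₂ (λ t′ s′ → if A S t′ s′ then value (up f) s else 0) (dec-enc c t) (dec-enc c s)

  rdf-down : ∀ f → RDF S f → IsRDF G (down f)
  rdf-down f rdf x x↦0 with rdf (dec c x) x↦0
  ... | s , adj , s↦2 = enc c s , subst (λ q → A S (dec c x) q ≡ true) (sym (dec-enc c s)) adj
                                , subst (λ q → value f q ≡ 2) (sym (dec-enc c s)) s↦2

  rdf-up : ∀ f → IsRDF G f → RDF S (up f)
  rdf-up f rdf t t↦0 with rdf (enc c t) t↦0
  ... | u , adj , u↦2 = dec c u , subst (λ q → A S q (dec c u) ≡ true) (dec-enc c t) adj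
                                , subst (λ q → value f q ≡ 2) (sym (enc-dec c u)) u↦2

  pid-down : ∀ f → PID S f → IsPID G (down f)
  pid-down f pid x x↦0 = trans (nbSum-down f x) (pid (dec c x) x↦0)

  pid-up : ∀ f → IsPID G f → PID S (up f)
  pid-up f pid t t↦0 = trans (sym (nbSum-up f t)) (pid (enc c t) t↦0)

  roman : ∀ {k} → MinW S (RDF S) k → RomanNumber G k
  roman {k} ((f , rdf , wf) , least) = (down f , rdf-down f rdf , trans (weight-down f) wf)
    , λ g rdf-g → subst (k ≤_) (sym (weight-up g)) (least (up g) (rdf-up g rdf-g))

  perfectItalian : ∀ {k} → MinW S (PID S) k → PerfectItalianNumber G k
  perfectItalian {k} ((f , pid , wf) , least) = (down f , pid-down f pid , trans (weight-down f) wf)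
    , λ g pid-g → subst (k ≤_) (sym (weight-up g)) (least (up g) (pid-up g pid-g))

_⊔_ : CGraph → CGraph → CGraph
S₁ ⊔ S₂ = record
  { code  = code S₁ ⊕ code S₂
  ; A     = A⊔
  ; A-sym = λ { (inj₁ a) (inj₁ b) → A-sym S₁ a b ; (inj₁ a) (inj₂ b) → refl
              ; (inj₂ a) (inj₁ b) → refl ; (inj₂ a) (inj₂ b) → A-sym S₂ a b }
  ; A-irr = λ { (inj₁ a) → A-irr S₁ a ; (inj₂ a) → A-irr S₂ a } }
  where
  A⊔ : El (code S₁ ⊕ code S₂) → El (code S₁ ⊕ code S₂) → Bool
  A⊔ (inj₁ a) (inj₁ b) = A S₁ a b
  A⊔ (inj₁ a) (inj₂ b) = false
  A⊔ (inj₂ a) (inj₁ b) = false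
  A⊔ (inj₂ a) (inj₂ b) = A S₂ a b

-- Both minimum weights are additive over disjoint unions: labellings of the
-- union are exactly pairs of labellings of the parts, and the conditions at
-- a vertex only involve its own part.
module Union (S₁ S₂ : CGraph) where
  private
    S = S₁ ⊔ S₂

  glue : Lab S₁ → Lab S₂ → Lab S
  glue f₁ f₂ = [ f₁ , f₂ ]′

  NB-left : ∀ (f : Lab S) a → NB S f (inj₁ a) ≡ NB S₁ (f ∘ inj₁) a
  NB-left f a = trans (cong (NB S₁ (f ∘ inj₁) a +_) (ΣT-zero (code S₂))) (+-identityʳ _)

  NB-right : ∀ (f : Lab S) a → NB S f (inj₂ a) ≡ NB S₂ (f ∘ inj₂) a
  NB-right f a = cong (_+ NB S₂ (f ∘ inj₂) a) (ΣT-zero (code S₁))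

  rdf-glue : ∀ f₁ f₂ → RDF S₁ f₁ → RDF S₂ f₂ → RDF S (glue f₁ f₂)
  rdf-glue f₁ f₂ rdf₁ rdf₂ (inj₁ a) a↦0 with rdf₁ a a↦0
  ... | s , adj , s↦2 = inj₁ s , adj , s↦2
  rdf-glue f₁ f₂ rdf₁ rdf₂ (inj₂ a) a↦0 with rdf₂ a a↦0
  ... | s , adj , s↦2 = inj₂ s , adj , s↦2

  rdf-left : ∀ f → RDF S f → RDF S₁ (f ∘ inj₁)
  rdf-left f rdf a a↦0 with rdf (inj₁ a) a↦0
  ... | inj₁ s , adj , s↦2 = s , adj , s↦2
  ... | inj₂ s , ()  , _

  rdf-right : ∀ f → RDF S f → RDF S₂ (f ∘ inj₂)
  rdf-right f rdf a a↦0 with rdf (inj₂ a) a↦0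
  ... | inj₂ s , adj , s↦2 = s , adj , s↦2
  ... | inj₁ s , ()  , _

  roman : ∀ {r₁ r₂} → MinW S₁ (RDF S₁) r₁ → MinW S₂ (RDF S₂) r₂ → MinW S (RDF S) (r₁ + r₂)
  roman ((f₁ , rdf₁ , w₁) , least₁) ((f₂ , rdf₂ , w₂) , least₂) =
    (glue f₁ f₂ , rdf-glue f₁ f₂ rdf₁ rdf₂ , cong₂ _+_ w₁ w₂) ,
    λ f rdf → +-mono-≤ (least₁ (f ∘ inj₁) (rdf-left f rdf)) (least₂ (f ∘ inj₂) (rdf-right f rdf))

  perfectItalian : ∀ {p₁ p₂} → MinW S₁ (PID S₁) p₁ → MinW S₂ (PID S₂) p₂ → MinW S (PID S) (p₁ + p₂)
  perfectItalian ((f₁ , pid₁ , w₁) , least₁) ((f₂ , pid₂ , w₂) , least₂) =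
    (glue f₁ f₂ , pid-glue , cong₂ _+_ w₁ w₂) ,
    λ f pid → +-mono-≤ (least₁ (f ∘ inj₁) (λ a a↦0 → trans (sym (NB-left f a)) (pid (inj₁ a) a↦0)))
                       (least₂ (f ∘ inj₂) (λ a a↦0 → trans (sym (NB-right f a)) (pid (inj₂ a) a↦0)))
    where
    pid-glue : PID S (glue f₁ f₂)
    pid-glue (inj₁ a) a↦0 = trans (NB-left (glue f₁ f₂) a) (pid₁ a a↦0)
    pid-glue (inj₂ a) a↦0 = trans (NB-right (glue f₁ f₂) a) (pid₂ a a↦0)

one two : Fin 3
one = suc zero
two = suc (suc zero)

positive : ∀ {m} → m ≢ 0 → 1 ≤ m
positive {zero}  m≢0 = contradiction refl m≢0
positive {suc m} _   = s≤s z≤n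

-- The edgeless graph on t vertices: every vertex must be labelled at least 1,
-- so both minimum weights equal t.
Edgeless : ℕ → CGraph
Edgeless t = fromEdges (fin t) (λ _ _ → false) (λ _ → refl)

roman-edgeless : ∀ t → MinW (Edgeless t) (RDF (Edgeless t)) t
roman-edgeless t = ((λ _ → one) , (λ _ ()) , Σ-ones t) ,
  λ f rdf → Σ-positive (value f) (λ i → positive (λ i↦0 → no-neighbour (rdf i i↦0)))
  where
  no-neighbour : ∀ {X : Set} {P : X → Set} → ¬ Σ X (λ s → (false ≡ true) × P s)
  no-neighbour (_ , () , _)

pid-edgeless : ∀ t → MinW (Edgeless t) (PID (Edgeless t)) t
pid-edgeless t = ((λ _ → one) , (λ _ ()) , Σ-ones t) ,
  λ f pid → Σ-positive (value f) (λ i → positive (λ i↦0 → 0≢2 (trans (sym (sum-replicate-zero t)) (pid i i↦0))))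
  where
  0≢2 : 0 ≢ 2
  0≢2 ()

Realizable : ℕ → ℕ → Set
Realizable a b = Σ Graph (λ G → RomanNumber G a × PerfectItalianNumber G b)

realize-padded : (S : CGraph) {a b : ℕ} → MinW S (RDF S) a → MinW S (PID S) b → ∀ t → Realizable (a + t) (b + t)
realize-padded S roman-S pid-S t =
  toGraph S+t ,
  Transport.roman S+t (Union.roman S (Edgeless t) roman-S (roman-edgeless t)) ,
  Transport.perfectItalian S+t (Union.perfectItalian S (Edgeless t) pid-S (pid-edgeless t))
  where
  S+t = S ⊔ Edgeless t

data LowEntries {n} (g : Fin n → ℕ) : Set where
  no-low  : (∀ h → 2 ≤ g h) → LowEntries g
  one-low : ∀ i → g i < 2 → (∀ h → h ≢ i → 2 ≤ g h) → LowEntries g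
  two-low : ∀ i k → i ≢ k → g i < 2 → g k < 2 → LowEntries g

lowEntries : ∀ {n} (g : Fin n → ℕ) → LowEntries g
lowEntries {n} g with all? (λ h → 2 ≤? g h)
... | yes high = no-low high
... | no ¬high with ¬∀⟶∃¬ n _ (λ h → 2 ≤? g h) ¬high
...   | i , i-low with all? (λ h → ¬? (h ≟F i) →-dec (2 ≤? g h))
...     | yes others-high = one-low i (≰⇒> i-low) others-high
...     | no ¬others-high with ¬∀⟶∃¬ n _ (λ h → ¬? (h ≟F i) →-dec (2 ≤? g h)) ¬others-high
...       | k , k-bad with k ≟F i | 2 ≤? g k
...         | yes k≡i | _        = contradiction (λ k≢i → contradiction k≡i k≢i) k-bad
...         | no  _   | yes k-high = contradiction (λ _ → k-high) k-bad
...         | no  k≢i | no k-low  = two-low i k (k≢i ∘ sym) (≰⇒> i-low) (≰⇒> k-low)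

data PairSums {n} (g : Fin n → ℕ) : Set where
  all-pairs-2 : (∀ i k → i ≢ k → g i + g k ≡ 2) → PairSums g
  bad-pair    : ∀ i k → i ≢ k → g i + g k ≢ 2 → PairSums g

pairSums : ∀ {n} (g : Fin n → ℕ) → PairSums g
pairSums {n} g with all? (λ i → all? (λ k → ¬? (i ≟F k) →-dec (g i + g k ≟ 2)))
... | yes all-2 = all-pairs-2 all-2
... | no ¬all-2 with ¬∀⟶∃¬ n _ (λ i → all? (λ k → ¬? (i ≟F k) →-dec (g i + g k ≟ 2))) ¬all-2
...   | i , i-bad with ¬∀⟶∃¬ n _ (λ k → ¬? (i ≟F k) →-dec (g i + g k ≟ 2)) i-bad
...     | k , k-bad with i ≟F k | g i + g k ≟ 2
...       | yes i≡k | _      = contradiction (λ i≢k → contradiction i≡k i≢k) k-bad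
...       | no  _   | yes is-2 = contradiction (λ _ → is-2) k-bad
...       | no  i≢k | no ¬2   = bad-pair i k i≢k ¬2

data ZeroEntry {n} (g : Fin n → ℕ) : Set where
  all-positive : (∀ h → 1 ≤ g h) → ZeroEntry g
  zero-at      : ∀ h → g h ≡ 0 → ZeroEntry g

zeroEntry : ∀ {n} (g : Fin n → ℕ) → ZeroEntry g
zeroEntry {n} g with all? (λ h → 1 ≤? g h)
... | yes pos = all-positive pos
... | no ¬pos with ¬∀⟶∃¬ n _ (λ h → 1 ≤? g h) ¬pos
...   | h , h-zero = zero-at h (n<1⇒n≡0 (≰⇒> h-zero))

-- The hub graph H(j): hubs 0,…,j and, for every hub i and every other hub
-- punchIn i k, m = 2(j+1) connectors (i , k , c) adjacent exactly to these
-- two hubs.  γ_R(H(j)) = 1 + 2j and γ_I^p(H(j)) = j + 1 when j ≥ 1.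
module Hub (j : ℕ) where
  m : ℕ
  m = suc j * 2

  Connector : Code
  Connector = fin (suc j) ⊗ (fin j ⊗ fin m)

  edge : El (fin (suc j) ⊕ Connector) → El (fin (suc j) ⊕ Connector) → Bool
  edge (inj₁ h) (inj₁ _)           = false
  edge (inj₁ h) (inj₂ (i , k , _)) = h == i ∨ h == punchIn i k
  edge (inj₂ _) _                  = false

  S : CGraph
  S = fromEdges (fin (suc j) ⊕ Connector) edge λ { (inj₁ _) → refl ; (inj₂ _) → refl }

  -- The weight of a labelling splits into the hub part and the connector
  -- part (definitionally, W S f = Σ[ hub f ] + connectors f).
  hub : Lab S → Fin (suc j) → ℕ
  hub f h = value f (inj₁ h)

  connector : Lab S → Fin (suc j) → Fin j → Fin m → ℕ
  connector f i k c = value f (inj₂ (i , k , c))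

  hubs≤W : ∀ f → Σ[ hub f ] ≤ W S f
  hubs≤W f = m≤m+n _ _

  connectors : Lab S → ℕ
  connectors f = ΣT Connector (value f ∘ inj₂)

  connectors≤W : ∀ f i k → (∀ c → 1 ≤ connector f i k c) → m ≤ W S f
  connectors≤W f i k positive-c = begin
    m                                                        ≤⟨ Σ-positive (connector f i k) positive-c ⟩
    Σ[ connector f i k ]                                     ≤⟨ Σ-point (λ k → Σ[ connector f i k ]) k ⟩
    ΣT (fin j ⊗ fin m) (λ y → value f (inj₂ (i , y)))        ≤⟨ ΣT-point (fin (suc j)) (λ i → ΣT (fin j ⊗ fin m) (λ y → value f (inj₂ (i , y)))) i ⟩
    connectors f                                             ≤⟨ m≤n+m _ Σ[ hub f ] ⟩
    W S f                                                    ∎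
    where open ≤-Reasoning

  NB-connector : ∀ f i k c → NB S f (inj₂ (i , k , c)) ≡ hub f i + hub f (punchIn i k)
  NB-connector f i k c = trans (cong (Σ[ (λ h → if h == i ∨ h == punchIn i k then hub f h else 0) ] +_) (ΣT-zero Connector))
    (trans (+-identityʳ _) (Σ-pair (hub f) i (punchIn i k) (punchInᵢ≢i i k ∘ sym)))

  rdf-connector : ∀ f → RDF S f → ∀ i k c → connector f i k c ≡ 0 → (hub f i ≡ 2) ⊎ (hub f (punchIn i k) ≡ 2)
  rdf-connector f rdf i k c c↦0 with rdf (inj₂ (i , k , c)) c↦0
  ... | inj₂ _ , ()  , _
  ... | inj₁ h , adj , h↦2 with ∨-true (h == i) (h == punchIn i k) adj
  ...   | inj₁ h=i = inj₁ (subst (λ q → hub f q ≡ 2) (==-sound h i h=i) h↦2)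
  ...   | inj₂ h=p = inj₂ (subst (λ q → hub f q ≡ 2) (==-sound h (punchIn i k) h=p) h↦2)

  -- Hub 0 gets 1, the other hubs 2: every connector sees a hub labelled 2.
  roman-labelling : Lab S
  roman-labelling (inj₁ zero)    = one
  roman-labelling (inj₁ (suc _)) = two
  roman-labelling (inj₂ _)       = zero

  roman-labelling-rdf : RDF S roman-labelling
  roman-labelling-rdf (inj₁ zero)    ()
  roman-labelling-rdf (inj₁ (suc _)) ()
  roman-labelling-rdf (inj₂ (zero  , k , c)) _ = inj₁ (suc k) , ==-refl (suc k) , refl
  roman-labelling-rdf (inj₂ (suc i , k , c)) _ = inj₁ (suc i) , cong (_∨ suc i == punchIn (suc i) k) (==-refl (suc i)) , refl

  roman-labelling-weight : W S roman-labelling ≡ 1 + j * 2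
  roman-labelling-weight = trans (cong₂ _+_ (cong suc (Σ-const j 2)) (ΣT-zero Connector)) (+-identityʳ _)

  -- Lower bound: with no hub below 2 the hubs alone weigh 2(j+1); with one
  -- hub below 2 the others weigh 2j, and a 0 there forces a connector
  -- labelled 2; with two hubs below 2 all their connectors are labelled.
  roman-lower : ∀ f → RDF S f → 1 + j * 2 ≤ W S f
  roman-lower f rdf with lowEntries (hub f)
  ... | no-low high = ≤-trans (n≤1+n _) (≤-trans (Σ-lower (hub f) 2 high) (hubs≤W f))
  ... | two-low i k i≢k i-low k-low =
    ≤-trans (n≤1+n _) (connectors≤W f i (punchOut i≢k) labelled)
    where
    k-low′ : hub f (punchIn i (punchOut i≢k)) < 2
    k-low′ = subst (λ q → hub f q < 2) (sym (punchIn-punchOut i≢k)) k-low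
    labelled : ∀ c → 1 ≤ connector f i (punchOut i≢k) c
    labelled c = positive λ c↦0 → [ (λ i↦2 → <⇒≢ i-low i↦2) , (λ k↦2 → <⇒≢ k-low′ k↦2) ]′
                                      (rdf-connector f rdf i (punchOut i≢k) c c↦0)
  ... | one-low i _ others with hub f i ≟ 0
  ...   | no i↦+  = ≤-trans (+-monoˡ-≤ (j * 2) (positive i↦+)) (≤-trans (Σ-except (hub f) i others) (hubs≤W f))
  ...   | yes i↦0 with rdf (inj₁ i) i↦0
  ...     | inj₁ _ , () , _
  ...     | inj₂ x , _  , x↦2 = begin
    1 + j * 2                                 ≤⟨ n≤1+n _ ⟩
    2 + j * 2                                 ≡⟨ +-comm 2 (j * 2) ⟩
    j * 2 + 2                                 ≡⟨ cong₂ (λ p q → p + j * 2 + q) (sym i↦0) (sym x↦2) ⟩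
    hub f i + j * 2 + value f (inj₂ x)        ≤⟨ +-mono-≤ (Σ-except (hub f) i others) (ΣT-point Connector (value f ∘ inj₂) x) ⟩
    Σ[ hub f ] + connectors f                 ∎
    where open ≤-Reasoning

  roman : MinW S (RDF S) (1 + j * 2)
  roman = (roman-labelling , roman-labelling-rdf , roman-labelling-weight) , roman-lower

  -- All hubs get 1: every connector sees exactly two hubs labelled 1.
  pid-labelling : Lab S
  pid-labelling (inj₁ _) = one
  pid-labelling (inj₂ _) = zero

  pid-labelling-pid : PID S pid-labelling
  pid-labelling-pid (inj₁ _) ()
  pid-labelling-pid (inj₂ (i , k , c)) _ = NB-connector pid-labelling i k c

  pid-labelling-weight : W S pid-labelling ≡ suc j
  pid-labelling-weight = trans (cong₂ _+_ (Σ-ones (suc j)) (ΣT-zero Connector)) (+-identityʳ _)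

  -- Lower bound (j ≥ 1): if two hubs do not sum to 2, all their connectors
  -- are labelled; otherwise either every hub is labelled, or one hub is 0
  -- and all the others are 2.
  pid-lower : 1 ≤ j → ∀ f → PID S f → suc j ≤ W S f
  pid-lower 1≤j f pid with pairSums (hub f)
  ... | bad-pair i k i≢k not-2 =
    ≤-trans (m≤m*n (suc j) 2) (connectors≤W f i (punchOut i≢k) labelled)
    where
    labelled : ∀ c → 1 ≤ connector f i (punchOut i≢k) c
    labelled c = positive λ c↦0 → not-2 (subst (λ q → hub f i + hub f q ≡ 2) (punchIn-punchOut i≢k)
                   (trans (sym (NB-connector f i (punchOut i≢k) c)) (pid (inj₂ (i , punchOut i≢k , c)) c↦0)))
  ... | all-pairs-2 sums-2 with zeroEntry (hub f)
  ...   | all-positive pos = ≤-trans (Σ-positive (hub f) pos) (hubs≤W f)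
  ...   | zero-at h h↦0 = begin
    suc j                ≤⟨ +-monoˡ-≤ j 1≤j ⟩
    j + j                ≡⟨ sym (trans (*-comm j 2) (cong (j +_) (+-identityʳ j))) ⟩
    j * 2                ≡⟨ cong (_+ j * 2) (sym h↦0) ⟩
    hub f h + j * 2      ≤⟨ Σ-except (hub f) h others-2 ⟩
    Σ[ hub f ]           ≤⟨ hubs≤W f ⟩
    W S f                ∎
    where
    open ≤-Reasoning
    others-2 : ∀ k → k ≢ h → 2 ≤ hub f k
    others-2 k k≢h = ≤-reflexive (sym (trans (cong (_+ hub f k) (sym h↦0)) (sums-2 h k (k≢h ∘ sym))))

  perfectItalian : 1 ≤ j → MinW S (PID S) (suc j)
  perfectItalian 1≤j = (pid-labelling , pid-labelling-pid , pid-labelling-weight) , pid-lower 1≤j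

-- The clique fan F(k): a centre u adjacent to a clique y₀,…,y_k and to k+4
-- leaves, and a pendant vertex w adjacent only to y₀.
-- γ_R(F(k)) = 3 and γ_I^p(F(k)) = k + 4.
module CliqueFan (k : ℕ) where
  Vertex : Code
  Vertex = fin 1 ⊕ (fin 1 ⊕ (fin (suc k) ⊕ fin (4 + k)))

  -- Edges are listed in one direction only: u–y, u–leaf, w–y₀ and y–y.
  edge : El Vertex → El Vertex → Bool
  edge (inj₁ _)               (inj₂ (inj₂ _))           = true
  edge (inj₂ (inj₁ _))        (inj₂ (inj₂ (inj₁ l)))    = l == zero
  edge (inj₂ (inj₂ (inj₁ l))) (inj₂ (inj₂ (inj₁ l′)))   = not (l == l′)
  edge _                      _                         = false

  edge-irr : ∀ t → edge t t ≡ false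
  edge-irr (inj₁ _)                = refl
  edge-irr (inj₂ (inj₁ _))         = refl
  edge-irr (inj₂ (inj₂ (inj₁ l)))  = cong not (==-refl l)
  edge-irr (inj₂ (inj₂ (inj₂ _)))  = refl

  S : CGraph
  S = fromEdges Vertex edge edge-irr

  u w : El Vertex
  u = inj₁ zero
  w = inj₂ (inj₁ zero)

  y : Fin (suc k) → El Vertex
  y l = inj₂ (inj₂ (inj₁ l))

  leaf : Fin (4 + k) → El Vertex
  leaf l = inj₂ (inj₂ (inj₂ l))

  val-y : Lab S → Fin (suc k) → ℕ
  val-y f = value f ∘ y

  val-leaf : Lab S → Fin (4 + k) → ℕ
  val-leaf f = value f ∘ leaf

  W-parts : ∀ f → W S f ≡ value f u + (value f w + (Σ[ val-y f ] + Σ[ val-leaf f ]))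
  W-parts f = cong₂ _+_ (+-identityʳ (value f u)) (cong (_+ (Σ[ val-y f ] + Σ[ val-leaf f ])) (+-identityʳ (value f w)))

  core≤W : ∀ f → value f u + (value f w + Σ[ val-y f ]) ≤ W S f
  core≤W f = subst (value f u + (value f w + Σ[ val-y f ]) ≤_) (sym (W-parts f)) (+-monoʳ-≤ (value f u) (+-monoʳ-≤ (value f w) (m≤m+n _ _)))

  leaves≤W : ∀ f → Σ[ val-leaf f ] ≤ W S f
  leaves≤W f = subst (Σ[ val-leaf f ] ≤_) (sym (W-parts f))
    (≤-trans (m≤n+m _ Σ[ val-y f ]) (≤-trans (m≤n+m _ (value f w)) (m≤n+m _ (value f u))))

  NB-leaf : ∀ f l → NB S f (leaf l) ≡ value f u
  NB-leaf f l = trans (cong₂ (λ p q → value f u + 0 + (p + q)) (sum-replicate-zero (suc k)) (sum-replicate-zero (4 + k)))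
                      (trans (+-identityʳ _) (+-identityʳ _))

  NB-w : ∀ f → NB S f w ≡ val-y f zero
  NB-w f = trans (cong₂ (λ p q → val-y f zero + p + q) (sum-replicate-zero k) (sum-replicate-zero (4 + k)))
                 (trans (+-identityʳ _) (+-identityʳ _))

  clique-nbrs : Lab S → Fin (suc k) → ℕ
  clique-nbrs f l = Σ[ (λ l′ → if A S (y l) (y l′) then val-y f l′ else 0) ]

  NB-y : ∀ f l → NB S f (y l) ≡ value f u + ((if l == zero then value f w else 0) + clique-nbrs f l)
  NB-y f l = trans (cong (λ q → value f u + 0 + ((if l == zero then value f w else 0) + 0 + (clique-nbrs f l + q)))
                         (sum-replicate-zero (4 + k)))
    (cong₂ _+_ (+-identityʳ (value f u))
               (cong₂ _+_ (+-identityʳ (if l == zero then value f w else 0)) (+-identityʳ (clique-nbrs f l))))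

  clique-adjacent : ∀ l l′ → l ≢ l′ → A S (y l) (y l′) ≡ true
  clique-adjacent l l′ l≢l′ = cong (λ b → not b ∨ not (l′ == l)) (==-false l≢l′)

  -- u ↦ 2 dominates everything except w, which gets 1.
  roman-labelling : Lab S
  roman-labelling (inj₁ _)         = two
  roman-labelling (inj₂ (inj₁ _))  = one
  roman-labelling (inj₂ (inj₂ _))  = zero

  roman-labelling-rdf : RDF S roman-labelling
  roman-labelling-rdf (inj₁ _)                ()
  roman-labelling-rdf (inj₂ (inj₁ _))         ()
  roman-labelling-rdf (inj₂ (inj₂ (inj₁ _)))  _ = u , refl , refl
  roman-labelling-rdf (inj₂ (inj₂ (inj₂ _)))  _ = u , refl , refl

  roman-labelling-weight : W S roman-labelling ≡ 3
  roman-labelling-weight = cong₂ (λ p q → 3 + (p + q)) (sum-replicate-zero (suc k)) (sum-replicate-zero (4 + k))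

  -- Lower bound: if u is not labelled 2, no leaf can be labelled 0; if it
  -- is, w or some y (a 2-neighbour of w) contributes at least 1 more.
  roman-lower : ∀ f → RDF S f → 3 ≤ W S f
  roman-lower f rdf with value f u ≟ 2
  ... | no u≢2 = ≤-trans (m≤m+n 3 (1 + k)) (≤-trans (Σ-positive (val-leaf f) labelled) (leaves≤W f))
    where
    labelled : ∀ l → 1 ≤ val-leaf f l
    labelled l = positive λ l↦0 → only-u (rdf (leaf l) l↦0)
      where
      only-u : ¬ Σ (El Vertex) (λ s → (A S (leaf l) s ≡ true) × (value f s ≡ 2))
      only-u (inj₁ zero , _ , u↦2)      = u≢2 u↦2
      only-u (inj₂ (inj₁ _) , () , _)
      only-u (inj₂ (inj₂ (inj₁ _)) , () , _)
      only-u (inj₂ (inj₂ (inj₂ _)) , () , _)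
  ... | yes u↦2 with value f w ≟ 0
  ...   | no w≢0 = begin
    2 + 1                                   ≤⟨ +-mono-≤ (≤-reflexive (sym u↦2)) (positive w≢0) ⟩
    value f u + value f w                   ≤⟨ +-monoʳ-≤ (value f u) (m≤m+n (value f w) _) ⟩
    value f u + (value f w + Σ[ val-y f ])  ≤⟨ core≤W f ⟩
    W S f                                   ∎
    where open ≤-Reasoning
  ...   | yes w↦0 with rdf w w↦0
  ...     | inj₁ _ , () , _
  ...     | inj₂ (inj₁ _) , () , _
  ...     | inj₂ (inj₂ (inj₂ _)) , () , _
  ...     | inj₂ (inj₂ (inj₁ l)) , _ , y↦2 = begin
    3                                       ≤⟨ n≤1+n 3 ⟩
    2 + 2                                   ≡⟨ cong₂ _+_ (sym u↦2) (sym y↦2) ⟩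
    value f u + val-y f l                   ≤⟨ +-monoʳ-≤ (value f u) (≤-trans (Σ-point (val-y f) l) (m≤n+m _ (value f w))) ⟩
    value f u + (value f w + Σ[ val-y f ])  ≤⟨ core≤W f ⟩
    W S f                                   ∎
    where open ≤-Reasoning

  roman : MinW S (RDF S) 3
  roman = (roman-labelling , roman-labelling-rdf , roman-labelling-weight) , roman-lower

  -- u ↦ 2, w and the clique ↦ 1: every leaf sees exactly u.
  pid-labelling : Lab S
  pid-labelling (inj₁ _)               = two
  pid-labelling (inj₂ (inj₁ _))        = one
  pid-labelling (inj₂ (inj₂ (inj₁ _))) = one
  pid-labelling (inj₂ (inj₂ (inj₂ _))) = zero

  pid-labelling-pid : PID S pid-labelling
  pid-labelling-pid (inj₁ _)               ()
  pid-labelling-pid (inj₂ (inj₁ _))        ()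
  pid-labelling-pid (inj₂ (inj₂ (inj₁ _))) ()
  pid-labelling-pid (inj₂ (inj₂ (inj₂ l))) _ = NB-leaf pid-labelling l

  pid-labelling-weight : W S pid-labelling ≡ 4 + k
  pid-labelling-weight = trans (cong₂ (λ p q → 3 + (p + q)) (Σ-ones (suc k)) (sum-replicate-zero (4 + k)))
                               (cong (3 +_) (+-identityʳ (suc k)))

  -- If u ↦ 2, a clique vertex labelled 0 forces all its other neighbours to
  -- 0; then y₀ and w would both be 0, leaving w with neighbourhood sum 0.
  -- Hence u ↦ 2 forces every clique vertex to be labelled.
  module _ (f : Lab S) (pid : PID S f) (u↦2 : value f u ≡ 2) where
    other-nbrs-zero : ∀ l → val-y f l ≡ 0 → (if l == zero then value f w else 0) + clique-nbrs f l ≡ 0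
    other-nbrs-zero l l↦0 = +-cancelˡ-≡ 2 _ 0
      (trans (cong (_+ ((if l == zero then value f w else 0) + clique-nbrs f l)) (sym u↦2))
             (trans (sym (NB-y f l)) (pid (y l) l↦0)))

    clique-zero : ∀ l → val-y f l ≡ 0 → ∀ l′ → l ≢ l′ → val-y f l′ ≡ 0
    clique-zero l l↦0 l′ l≢l′ = n≤0⇒n≡0 (begin
      val-y f l′                                           ≡⟨ cong (λ b → if b then val-y f l′ else 0) (clique-adjacent l l′ l≢l′) ⟨
      (if A S (y l) (y l′) then val-y f l′ else 0)         ≤⟨ Σ-point (λ l″ → if A S (y l) (y l″) then val-y f l″ else 0) l′ ⟩
      clique-nbrs f l                                      ≡⟨ m+n≡0⇒n≡0 (if l == zero then value f w else 0) (other-nbrs-zero l l↦0) ⟩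
      0                                                    ∎)
      where open ≤-Reasoning

    y₀-zero : ∀ l → val-y f l ≡ 0 → val-y f zero ≡ 0
    y₀-zero zero    l↦0 = l↦0
    y₀-zero (suc l) l↦0 = clique-zero (suc l) l↦0 zero (λ ())

    clique-labelled : ∀ l → 1 ≤ val-y f l
    clique-labelled l = positive λ l↦0 → 0≢2 (y₀-zero l l↦0) (trans (sym (NB-w f)) (pid w (w-zero (y₀-zero l l↦0))))
      where
      w-zero : val-y f zero ≡ 0 → value f w ≡ 0
      w-zero y₀↦0 = m+n≡0⇒m≡0 (value f w) (other-nbrs-zero zero y₀↦0)
      0≢2 : ∀ {x} → x ≡ 0 → x ≢ 2
      0≢2 refl ()

  -- Lower bound: if u is not labelled 2, every leaf is labelled; otherwise
  -- the clique is labelled, and w ↦ 0 forces y₀ ↦ 2.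
  pid-lower : ∀ f → PID S f → 4 + k ≤ W S f
  pid-lower f pid with value f u ≟ 2
  ... | no u≢2 = ≤-trans (Σ-positive (val-leaf f) labelled) (leaves≤W f)
    where
    labelled : ∀ l → 1 ≤ val-leaf f l
    labelled l = positive λ l↦0 → u≢2 (trans (sym (NB-leaf f l)) (pid (leaf l) l↦0))
  ... | yes u↦2 with value f w ≟ 0
  ...   | no w≢0 = begin
    2 + (1 + suc k)                          ≤⟨ +-mono-≤ (≤-reflexive (sym u↦2)) (+-mono-≤ (positive w≢0) (Σ-positive (val-y f) (clique-labelled f pid u↦2))) ⟩
    value f u + (value f w + Σ[ val-y f ])   ≤⟨ core≤W f ⟩
    W S f                                    ∎
    where open ≤-Reasoning
  ...   | yes w↦0 = begin
    2 + (0 + (2 + k))                        ≤⟨ +-mono-≤ (≤-reflexive (sym u↦2)) (+-mono-≤ (≤-reflexive (sym w↦0))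
                                                  (+-mono-≤ (≤-reflexive (sym y₀↦2)) (Σ-positive (val-y f ∘ suc) (clique-labelled f pid u↦2 ∘ suc)))) ⟩
    value f u + (value f w + Σ[ val-y f ])   ≤⟨ core≤W f ⟩
    W S f                                    ∎
    where
    open ≤-Reasoning
    y₀↦2 : val-y f zero ≡ 2
    y₀↦2 = trans (sym (NB-w f)) (pid w w↦0)

  perfectItalian : MinW S (PID S) (4 + k)
  perfectItalian = (pid-labelling , pid-labelling-pid , pid-labelling-weight) , pid-lower

realize-equal : ∀ a → Realizable a a
realize-equal a = realize-padded (Edgeless 0) (roman-edgeless 0) (pid-edgeless 0) a

-- 3 ≤ a < b: the clique fan F(b − a − 1) padded by a − 3 isolated vertices.
realize-below : ∀ {a b} → 3 ≤ a → a < b → Realizable a b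
realize-below 3≤a a<b with m≤n⇒∃[o]m+o≡n 3≤a
... | t , refl with m≤n⇒∃[o]m+o≡n a<b
...   | k , refl = subst (Realizable (3 + t)) (cong (4 +_) (+-comm k t))
  (realize-padded (CliqueFan.S k) (CliqueFan.roman k) (CliqueFan.perfectItalian k) t)

-- b < a < 2b: the hub graph H(a − b) padded by 2b − a − 1 isolated vertices.
realize-above : ∀ {a b} → b < a → a < 2 * b → Realizable a b
realize-above {b = b} b<a a<2b with m≤n⇒∃[o]m+o≡n b<a
... | d , refl with m≤n⇒∃[o]m+o≡n (+-cancelˡ-≤ b (2 + d) b room)
  where
  -- a = b + 1 + d < 2b leaves room for t = b − d − 2 padding vertices.
  room : b + (2 + d) ≤ b + b
  room = subst₂ _≤_ (sym (trans (+-suc b (suc d)) (cong suc (+-suc b d)))) (cong (b +_) (+-identityʳ b)) a<2b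
...   | t , refl = subst (λ r → Realizable r (2 + d + t)) (hub-arith d t)
  (realize-padded (Hub.S (suc d)) (Hub.roman (suc d)) (Hub.perfectItalian (suc d) (s≤s z≤n)) t)
  where
  hub-arith : ∀ d t → 1 + suc d * 2 + t ≡ suc (2 + d + t) + d
  hub-arith = solve-∀

-- The hypothesis a ≤ 2b − 1 in truncated-subtraction form.
a≤2b∸1⇒a<2b : ∀ {a b} → 1 ≤ b → a ≤ 2 * b ∸ 1 → a < 2 * b
a≤2b∸1⇒a<2b {a} {b} 1≤b a≤2b∸1 = subst (_≤ 2 * b) (+-comm a 1) (m≤o∸n⇒m+n≤o a (≤-trans 1≤b (m≤m+n b (b + 0))) a≤2b∸1)

theorem5p2 : (a b : ℕ) → 3 ≤ a → 3 ≤ b → a ≤ 2 * b ∸ 1 →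
    Σ Graph (λ G → RomanNumber G a × PerfectItalianNumber G b)
theorem5p2 a b 3≤a 3≤b a≤2b∸1 with <-cmp a b
... | tri< a<b _ _  = realize-below 3≤a a<b
... | tri≈ _ refl _ = realize-equal a
... | tri> _ _ b<a  = realize-above b<a (a≤2b∸1⇒a<2b (≤-trans (s≤s z≤n) 3≤b) a≤2b∸1)
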